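{- There are absolute constants $c,C>0$ such that for every $m\ge1$ there exists a family of vectors $\mathcal{F}\subseteq\{0,1\}^m$ such that $P=\mathrm{conv}(\mathcal{F})$ contains a Euclidean ball of radius at least $c$, $P$ has unary facet complexity $1$, and if $X_1,X_2,\dots\in\mathcal{F}$ are independent uniform samples from $\mathcal{F}$, then for every $N\le2^m$, $$\Pr\Big[\frac1N\sum_{i=1}^N X_i\notin\partial P\Big]\le C\frac{N}{2^m},$$ where $\partial P$ denotes the boundary of $P$.
   Context: Unary facet complexity: for a polytope $P\subseteq\mathbb{R}^m$ with integer vertices, the smallest $M\in\mathbb{N}$ such that $P=\{x:\langle a_i,x\rangle\le b_i,\ i\in I\}\cap H$ with $I$ finite, $a_i\in\mathbb{Z}^m$, $\|a_i\|_\infty\le M$, $b_i\in\mathbb{R}$, $H$ a linear subspace of $\mathbb{R}^m$.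
   Formalization: The ball, the boundary ∂P and the facet description are taken over ℚ^m rather than ℝ^m, with rational centre and radius, rational $b_i$, and H the common kernel of rational vectors. -}

module Defs where

open import Data.Nat as ℕ using (ℕ; zero; suc)
open import Data.Integer as ℤ using (ℤ)
open import Data.Rational as ℚ using (ℚ; 0ℚ; 1ℚ; _+_; _*_; _-_; _≤_; _<_; _/_)
open import Data.Fin using (Fin) renaming (zero to fz; suc to fs)
open import Data.Bool using (Bool; true; false)
open import Data.Vec as V using (Vec)
open import Data.List as L using (List; length)
open import Data.List.Relation.Unary.All using (All)
open import Data.Product using (Σ; ∃; _×_; _,_)
open import Relation.Binary.PropositionalEquality using (_≡_)
open import Relation.Nullary using (¬_)
open import Function.Bundles using (_⇔_)

Pt : ℕ → Set
Pt m = Fin m → ℚ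

Σℚ : ∀ {n} → (Fin n → ℚ) → ℚ
Σℚ {zero}  f = 0ℚ
Σℚ {suc n} f = f fz + Σℚ (λ i → f (fs i))

ℕ→ℚ : ℕ → ℚ
ℕ→ℚ n = ℤ.+ n / 1

ℤ→ℚ : ℤ → ℚ
ℤ→ℚ z = z / 1

b2q : Bool → ℚ
b2q true  = 1ℚ
b2q false = 0ℚ

toPt : ∀ {m} → Vec Bool m → Pt m
toPt v i = b2q (V.lookup v i)

dot : ∀ {m} → Pt m → Pt m → ℚ
dot a x = Σℚ (λ i → a i * x i)

sqDist : ∀ {m} → Pt m → Pt m → ℚ
sqDist x y = Σℚ (λ i → (x i - y i) * (x i - y i))

InConv : ∀ {m} → List (Vec Bool m) → Pt m → Set
InConv F x =
  Σ (Fin (length F) → ℚ) λ w →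
    (∀ j → 0ℚ ≤ w j) × (Σℚ w ≡ 1ℚ) ×
    (∀ i → Σℚ (λ j → w j * toPt (L.lookup F j) i) ≡ x i)

ContainsBall : ∀ {m} → List (Vec Bool m) → ℚ → Set
ContainsBall {m} F c =
  Σ (Pt m) λ z → ∀ (y : Pt m) → sqDist y z ≤ c * c → InConv F y

-- conv(F) = {x : ⟨a,x⟩ ≤ b for (a,b) ∈ ineqs} ∩ H, with integer a, ‖a‖∞ ≤ M,
-- and H = {x : ⟨h,x⟩ = 0 for h ∈ eqs} a linear subspace.
FacetComplexityAtMost : ∀ {m} → ℕ → List (Vec Bool m) → Set
FacetComplexityAtMost {m} M F =
  Σ (List ((Fin m → ℤ) × ℚ)) λ ineqs →
  Σ (List (Pt m)) λ eqs →
    All (λ ab → ∀ i → ℤ.∣ Data.Product.proj₁ ab i ∣ ℕ.≤ M) ineqs ×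
    (∀ (x : Pt m) →
       InConv F x ⇔
       (All (λ ab → dot (λ i → ℤ→ℚ (Data.Product.proj₁ ab i)) x ≤ Data.Product.proj₂ ab) ineqs
        × All (λ h → dot h x ≡ 0ℚ) eqs))

UnaryFacetComplexityOne : ∀ {m} → List (Vec Bool m) → Set
UnaryFacetComplexityOne F = FacetComplexityAtMost 1 F × ¬ FacetComplexityAtMost 0 F

InBoundary : ∀ {m} → List (Vec Bool m) → Pt m → Set
InBoundary {m} F x =
  InConv F x ×
  (∀ ε → 0ℚ < ε → Σ (Pt m) λ y → (sqDist y x < ε) × ¬ InConv F y)

-- average (1/N) Σ_k X_k of a sample tuple (given by indices into F), N = suc n
average : ∀ {m} (F : List (Vec Bool m)) {n} → Vec (Fin (length F)) (suc n) → Pt m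
average F {n} t i =
  (ℤ.+ 1 / suc n) * Σℚ (λ k → toPt (L.lookup F (V.lookup t k)) i)

-- F is the apex 0 together with the top face {1} × {0,1}^(m-1), so conv F is the pyramid
-- 0 ≤ xᵢ ≤ x₀ ≤ 1 (i ≥ 1). Its facet normals have entries in {0, ±1}; with only zero normals
-- conv F would be closed under scaling, yet it contains e₀ but not 2e₀. The pyramid contains the
-- ball of radius 1/8 about (3/4, 3/8, …, 3/8).
-- A sample that never picks the apex averages to a point with x₀ = 1, the maximum of x₀ on
-- conv F, hence to a boundary point. So every sample with interior average contains the apex:
-- at most N·|F|^(N-1) of the |F|^N samples, and N/|F| ≤ 2N/2^m. No restriction on N is needed.

{-# OPTIONS --safe #-}
module Submission where

open import Defs
open import Data.Nat as ℕ using (ℕ; suc; _^_)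
open import Data.Rational as ℚ using (ℚ; 0ℚ; _*_; _≤_; _<_)
open import Data.Fin using (Fin)
open import Data.Bool using (Bool)
open import Data.Vec using (Vec)
open import Data.List using (List; length)
open import Data.List.Relation.Unary.All using (All)
open import Data.List.Relation.Unary.Unique.Propositional using (Unique)
open import Data.Product using (Σ; _×_)
open import Relation.Nullary using (¬_)

open import Data.Nat using (zero; z≤n; s≤s)
import Data.Nat.Properties as ℕP
import Data.Nat.Coprimality as Coprime
open import Data.Nat.Tactic.RingSolver using (solve-∀)
open import Data.Integer as ℤ using (ℤ; 0ℤ; 1ℤ; -1ℤ)
import Data.Integer.Properties as ℤP
open import Data.Rational using (1ℚ; ½; _+_; _-_; -_; _/_; mkℚ)
import Data.Rational.Properties as ℚP
open import Data.Rational.Solver using (module +-*-Solver)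
open +-*-Solver using (solve; _:+_; _:*_; :-_; _:-_; _:=_; con)
open import Data.Fin as Fin using () renaming (zero to fz; suc to fs)
open import Data.Bool using (true; false)
open import Data.Vec as V using ([]; _∷_)
open import Data.Vec.Functional using (tail)
import Data.Vec.Properties as VP
import Data.Vec.Relation.Unary.Any as VAny
open import Data.Vec.Membership.Propositional using () renaming (_∈_ to _∈ᵥ_)
import Data.Vec.Membership.Propositional.Properties as ∈ᵥP
open import Data.List as L using (_++_; cartesianProductWith)
import Data.List.Properties as LP
import Data.List.Relation.Unary.All as All
import Data.List.Relation.Unary.All.Properties as AllP
open import Data.List.Relation.Unary.Any using (here; there)
import Data.List.Relation.Unary.AllPairs as AllPairs
import Data.List.Relation.Unary.Unique.Propositional.Properties as UniqueP
open import Data.List.Membership.Propositional using (_∈_)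
import Data.List.Membership.Propositional.Properties as ∈P
open import Data.List.Relation.Binary.Subset.Propositional using (_⊆_)
open import Data.Product using (_,_; proj₁; proj₂)
open import Data.Sum using (inj₁; inj₂)
open import Function.Base using (_∘_)
open import Function.Bundles using (mk⇔; Equivalence)
open import Relation.Binary.PropositionalEquality
open import Relation.Nullary using (yes; no; contradiction)
open import Relation.Nullary.Decidable using (from-yes; from-no)

-- ℕ→ℚ n is already in lowest terms; rewriting with this lets ℚ's operations compute on it.
ℕ→ℚ≡mkℚ : ∀ n → ℕ→ℚ n ≡ mkℚ (ℤ.+ n) 0 (Coprime.sym (Coprime.1-coprimeTo n))
ℕ→ℚ≡mkℚ n = ℚP.normalize-coprime _

ℕ→ℚ-suc : ∀ n → ℕ→ℚ (suc n) ≡ 1ℚ + ℕ→ℚ n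
ℕ→ℚ-suc n rewrite ℕ→ℚ≡mkℚ n =
  cong (_/ 1) (trans (ℤP.pos-+ 1 n) (cong (ℤ._+_ 1ℤ) (sym (ℤP.*-identityʳ (ℤ.+ n)))))

ℕ→ℚ-* : ∀ a b → ℕ→ℚ (a ℕ.* b) ≡ ℕ→ℚ a * ℕ→ℚ b
ℕ→ℚ-* a b rewrite ℕ→ℚ≡mkℚ a | ℕ→ℚ≡mkℚ b = cong (_/ 1) (ℤP.pos-* a b)

ℕ→ℚ-mono-≤ : ∀ {a b} → a ℕ.≤ b → ℕ→ℚ a ≤ ℕ→ℚ b
ℕ→ℚ-mono-≤ {a} {b} a≤b rewrite ℕ→ℚ≡mkℚ a | ℕ→ℚ≡mkℚ b =
  ℚ.*≤* (subst₂ ℤ._≤_ (sym (ℤP.*-identityʳ _)) (sym (ℤP.*-identityʳ _)) (ℤ.+≤+ a≤b))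

ℕ→ℚ-mono-≤-* : ∀ a b c d e → a ℕ.* b ℕ.≤ c ℕ.* d ℕ.* e →
  ℕ→ℚ a * ℕ→ℚ b ≤ ℕ→ℚ c * ℕ→ℚ d * ℕ→ℚ e
ℕ→ℚ-mono-≤-* a b c d e ab≤cde = subst₂ _≤_
  (ℕ→ℚ-* a b)
  (trans (ℕ→ℚ-* (c ℕ.* d) e) (cong (_* ℕ→ℚ e) (ℕ→ℚ-* c d)))
  (ℕ→ℚ-mono-≤ ab≤cde)

1/[1+n]*[1+n]≡1 : ∀ n → (ℤ.+ 1 / suc n) * ℕ→ℚ (suc n) ≡ 1ℚ
1/[1+n]*[1+n]≡1 n
  rewrite ℕ→ℚ≡mkℚ (suc n) | ℚP.normalize-coprime {1} {n} (Coprime.1-coprimeTo (suc n)) =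
  ℚP.*-inverseˡ (mkℚ (ℤ.+ suc n) 0 (Coprime.sym (Coprime.1-coprimeTo (suc n))))

0≤1/[1+n] : ∀ n → 0ℚ ≤ ℤ.+ 1 / suc n
0≤1/[1+n] n = ℚP.nonNegative⁻¹ _ {{ℚP.normalize-nonNeg 1 (suc n)}}

0≤1 : 0ℚ ≤ 1ℚ
0≤1 = from-yes (0ℚ ℚP.≤? 1ℚ)

0≤* : ∀ {p q} → 0ℚ ≤ p → 0ℚ ≤ q → 0ℚ ≤ p * q
0≤* {p} {q} 0≤p 0≤q = ℚP.nonNegative⁻¹ _
  {{ℚP.nonNeg*nonNeg⇒nonNeg p {{ℚ.nonNegative 0≤p}} q {{ℚ.nonNegative 0≤q}}}}

*-monoˡ-≤-0≤ : ∀ {r p q} → 0ℚ ≤ r → p ≤ q → r * p ≤ r * q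
*-monoˡ-≤-0≤ {r} 0≤r = ℚP.*-monoˡ-≤-nonNeg r {{ℚ.nonNegative 0≤r}}

p≤q⇒0≤q-p : ∀ {p q} → p ≤ q → 0ℚ ≤ q - p
p≤q⇒0≤q-p {p} {q} p≤q = subst (_≤ q - p) (ℚP.+-inverseʳ p) (ℚP.+-monoˡ-≤ (- p) p≤q)

neg-involutive : ∀ p → - - p ≡ p
neg-involutive = solve 1 (λ p → :- (:- p) := p) refl

-p*-p≡p*p : ∀ p → - p * - p ≡ p * p
-p*-p≡p*p = solve 1 (λ p → :- p :* :- p := p :* p) refl

0≤p*p : ∀ p → 0ℚ ≤ p * p
0≤p*p p with ℚP.≤-total 0ℚ p
... | inj₁ 0≤p = 0≤* 0≤p 0≤p
... | inj₂ p≤0 = subst (0ℚ ≤_) (-p*-p≡p*p p) (0≤* 0≤-p 0≤-p)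
  where
  0≤-p : 0ℚ ≤ - p
  0≤-p = ℚP.neg-antimono-≤ p≤0

p*p≤q*q⇒p≤q : ∀ {p q} → 0ℚ ≤ q → p * p ≤ q * q → p ≤ q
p*p≤q*q⇒p≤q {p} {q} 0≤q p²≤q² =
  ℚP.≮⇒≥ λ q<p → ℚP.<-irrefl refl (ℚP.<-≤-trans (q²<p² q<p) p²≤q²)
  where
  q²<p² : q < p → q * q < p * p
  q²<p² q<p = ℚP.≤-<-trans (*-monoˡ-≤-0≤ 0≤q (ℚP.<⇒≤ q<p))
    (ℚP.*-monoˡ-<-pos p {{ℚ.positive (ℚP.≤-<-trans 0≤q q<p)}} q<p)

p*p≤q*q⇒-q≤p≤q : ∀ {p q} → 0ℚ ≤ q → p * p ≤ q * q → - q ≤ p × p ≤ q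
p*p≤q*q⇒-q≤p≤q {p} {q} 0≤q p²≤q² =
  subst (- q ≤_) (neg-involutive p)
    (ℚP.neg-antimono-≤ (p*p≤q*q⇒p≤q 0≤q (subst (_≤ q * q) (sym (-p*-p≡p*p p)) p²≤q²))) ,
  p*p≤q*q⇒p≤q 0≤q p²≤q²

∃δ²<ε : ∀ ε → 0ℚ < ε → Σ ℚ λ δ → 0ℚ < δ × δ * δ < ε
∃δ²<ε ε 0<ε with ℚP.≤-total ε 1ℚ
... | inj₂ 1≤ε =
  ½ , from-yes (0ℚ ℚP.<? ½) , ℚP.<-≤-trans (from-yes (½ * ½ ℚP.<? 1ℚ)) 1≤ε
... | inj₁ ε≤1 = δ , 0<δ , ℚP.≤-<-trans δ²≤δ δ<ε
  where
  instance
    _ : ℚ.Positive ε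
    _ = ℚ.positive 0<ε
  δ : ℚ
  δ = ε * ½
  0<δ : 0ℚ < δ
  0<δ = subst (_< δ) (ℚP.*-zeroʳ ε) (ℚP.*-monoʳ-<-pos ε (from-yes (0ℚ ℚP.<? ½)))
  δ<ε : δ < ε
  δ<ε = subst (δ <_) (ℚP.*-identityʳ ε) (ℚP.*-monoʳ-<-pos ε (from-yes (½ ℚP.<? 1ℚ)))
  δ²≤δ : δ * δ ≤ δ
  δ²≤δ = subst (δ * δ ≤_) (ℚP.*-identityʳ δ)
    (*-monoˡ-≤-0≤ (ℚP.<⇒≤ 0<δ) (ℚP.≤-trans (ℚP.<⇒≤ δ<ε) ε≤1))

Σℚ-cong : ∀ {n} {f g : Fin n → ℚ} → (∀ i → f i ≡ g i) → Σℚ f ≡ Σℚ g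
Σℚ-cong {zero}  f≡g = refl
Σℚ-cong {suc n} f≡g = cong₂ _+_ (f≡g fz) (Σℚ-cong (f≡g ∘ fs))

Σℚ-0 : ∀ {n} {f : Fin n → ℚ} → (∀ i → f i ≡ 0ℚ) → Σℚ f ≡ 0ℚ
Σℚ-0 {zero}  f≡0 = refl
Σℚ-0 {suc n} f≡0 = trans (cong₂ _+_ (f≡0 fz) (Σℚ-0 (f≡0 ∘ fs))) (ℚP.+-identityˡ 0ℚ)

Σℚ-mono-≤ : ∀ {n} {f g : Fin n → ℚ} → (∀ i → f i ≤ g i) → Σℚ f ≤ Σℚ g
Σℚ-mono-≤ {zero}  f≤g = ℚP.≤-refl
Σℚ-mono-≤ {suc n} f≤g = ℚP.+-mono-≤ (f≤g fz) (Σℚ-mono-≤ (f≤g ∘ fs))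

Σℚ-nonNeg : ∀ {n} {f : Fin n → ℚ} → (∀ i → 0ℚ ≤ f i) → 0ℚ ≤ Σℚ f
Σℚ-nonNeg {n} {f} 0≤f = subst (_≤ Σℚ f) (Σℚ-0 {n} λ _ → refl) (Σℚ-mono-≤ 0≤f)

Σℚ-*ˡ : ∀ {n} c (f : Fin n → ℚ) → Σℚ (λ i → c * f i) ≡ c * Σℚ f
Σℚ-*ˡ {zero}  c f = sym (ℚP.*-zeroʳ c)
Σℚ-*ˡ {suc n} c f = trans (cong (c * f fz +_) (Σℚ-*ˡ c (f ∘ fs))) (sym (ℚP.*-distribˡ-+ c _ _))

Σℚ-1 : ∀ n → Σℚ {n} (λ _ → 1ℚ) ≡ ℕ→ℚ n
Σℚ-1 zero    = refl
Σℚ-1 (suc n) = trans (cong (1ℚ +_) (Σℚ-1 n)) (sym (ℕ→ℚ-suc n))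

1/[1+n]*Σℚ1≡1 : ∀ n → (ℤ.+ 1 / suc n) * Σℚ {suc n} (λ _ → 1ℚ) ≡ 1ℚ
1/[1+n]*Σℚ1≡1 n = trans (cong ((ℤ.+ 1 / suc n) *_) (Σℚ-1 (suc n))) (1/[1+n]*[1+n]≡1 n)

f≤Σℚf : ∀ {n} {f : Fin n → ℚ} → (∀ i → 0ℚ ≤ f i) → ∀ j → f j ≤ Σℚ f
f≤Σℚf {suc n} {f} 0≤f fz =
  subst (_≤ Σℚ f) (ℚP.+-identityʳ (f fz)) (ℚP.+-monoʳ-≤ (f fz) (Σℚ-nonNeg (0≤f ∘ fs)))
f≤Σℚf {suc n} {f} 0≤f (fs j) =
  subst (_≤ Σℚ f) (ℚP.+-identityˡ (f (fs j)))
    (ℚP.+-mono-≤ (0≤f fz) (f≤Σℚf (0≤f ∘ fs) j))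

dot-*ʳ : ∀ {n} (a x : Pt n) c → dot a (λ i → c * x i) ≡ c * dot a x
dot-*ʳ a x c = trans (Σℚ-cong λ i → swap (a i) c (x i)) (Σℚ-*ˡ c (λ i → a i * x i))
  where
  swap : ∀ a c x → a * (c * x) ≡ c * (a * x)
  swap = solve 3 (λ a c x → a :* (c :* x) := c :* (a :* x)) refl

ΣL : ∀ {A : Set} → List A → (A → ℚ) → ℚ
ΣL L.[]       h = 0ℚ
ΣL (x L.∷ xs) h = h x + ΣL xs h

Σℚ-lookup : ∀ {A : Set} (xs : List A) h → Σℚ (λ j → h (L.lookup xs j)) ≡ ΣL xs h
Σℚ-lookup L.[]       h = refl
Σℚ-lookup (x L.∷ xs) h = cong (h x +_) (Σℚ-lookup xs h)

ΣL-cong : ∀ {A : Set} (xs : List A) {g h : A → ℚ} → (∀ a → g a ≡ h a) →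
  ΣL xs g ≡ ΣL xs h
ΣL-cong L.[]       g≡h = refl
ΣL-cong (x L.∷ xs) g≡h = cong₂ _+_ (g≡h x) (ΣL-cong xs g≡h)

ΣL-*ˡ : ∀ {A : Set} (xs : List A) c h → ΣL xs (λ a → c * h a) ≡ c * ΣL xs h
ΣL-*ˡ L.[]       c h = sym (ℚP.*-zeroʳ c)
ΣL-*ˡ (x L.∷ xs) c h = trans (cong (c * h x +_) (ΣL-*ˡ xs c h)) (sym (ℚP.*-distribˡ-+ c _ _))

ΣL-++ : ∀ {A : Set} (xs ys : List A) h → ΣL (xs ++ ys) h ≡ ΣL xs h + ΣL ys h
ΣL-++ L.[]       ys h = sym (ℚP.+-identityˡ _)
ΣL-++ (x L.∷ xs) ys h = trans (cong (h x +_) (ΣL-++ xs ys h)) (sym (ℚP.+-assoc (h x) _ _))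

ΣL-map : ∀ {A B : Set} (f : A → B) (xs : List A) h → ΣL (L.map f xs) h ≡ ΣL xs (h ∘ f)
ΣL-map f L.[]       h = refl
ΣL-map f (x L.∷ xs) h = cong (h (f x) +_) (ΣL-map f xs h)

ΣL-cartesianProductWith : ∀ {A B C : Set} (f : A → B → C) xs ys h →
  ΣL (cartesianProductWith f xs ys) h ≡ ΣL xs (λ a → ΣL ys (λ b → h (f a b)))
ΣL-cartesianProductWith f L.[]       ys h = refl
ΣL-cartesianProductWith f (x L.∷ xs) ys h = begin
  ΣL (L.map (f x) ys ++ cartesianProductWith f xs ys) h
    ≡⟨ ΣL-++ (L.map (f x) ys) _ h ⟩
  ΣL (L.map (f x) ys) h + ΣL (cartesianProductWith f xs ys) h
    ≡⟨ cong₂ _+_ (ΣL-map (f x) ys h) (ΣL-cartesianProductWith f xs ys h) ⟩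
  ΣL ys (h ∘ f x) + ΣL xs (λ a → ΣL ys (λ b → h (f a b)))
    ∎
  where open ≡-Reasoning

length-cartesianProductWith : ∀ {A B C : Set} (f : A → B → C) xs ys →
  length (cartesianProductWith f xs ys) ≡ length xs ℕ.* length ys
length-cartesianProductWith f L.[]       ys = refl
length-cartesianProductWith f (x L.∷ xs) ys =
  trans (LP.length-++ (L.map (f x) ys))
        (cong₂ ℕ._+_ (LP.length-map (f x) ys) (length-cartesianProductWith f xs ys))

∈-++-∷⁻ : ∀ {A : Set} (xs : List A) {ys x y} → y ∈ xs ++ x L.∷ ys → x ≢ y →
  y ∈ xs ++ ys
∈-++-∷⁻ xs y∈ x≢y with ∈P.∈-++⁻ xs y∈
... | inj₁ y∈xs         = ∈P.∈-++⁺ˡ y∈xs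
... | inj₂ (here y≡x)   = contradiction (sym y≡x) x≢y
... | inj₂ (there y∈ys) = ∈P.∈-++⁺ʳ xs y∈ys

Unique-⊆⇒length≤ : ∀ {A : Set} {xs ys : List A} → Unique xs → xs ⊆ ys →
  length xs ℕ.≤ length ys
Unique-⊆⇒length≤ {xs = L.[]}     _                      _     = z≤n
Unique-⊆⇒length≤ {xs = x L.∷ xs} (x∉xs AllPairs.∷ uxs) xs⊆ys
  with us , vs , refl ← ∈P.∈-∃++ (xs⊆ys (here refl)) =
  ℕP.≤-trans (s≤s (Unique-⊆⇒length≤ uxs xs⊆us++vs))
             (ℕP.≤-reflexive (sym (LP.length-++-sucʳ us x vs)))
  where
  xs⊆us++vs : xs ⊆ us ++ vs
  xs⊆us++vs y∈xs = ∈-++-∷⁻ us (xs⊆ys (there y∈xs)) (All.lookup x∉xs y∈xs)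

vecsOver : ∀ {A : Set} → List A → ∀ n → List (Vec A n)
vecsOver xs zero    = L.[ [] ]
vecsOver xs (suc n) = cartesianProductWith _∷_ xs (vecsOver xs n)

∈-vecsOver : ∀ {A : Set} {xs : List A} → (∀ a → a ∈ xs) →
  ∀ {n} (v : Vec A n) → v ∈ vecsOver xs n
∈-vecsOver all∈ []      = here refl
∈-vecsOver all∈ (a ∷ v) = ∈P.∈-cartesianProductWith⁺ _∷_ (all∈ a) (∈-vecsOver all∈ v)

length-vecsOver : ∀ {A : Set} (xs : List A) n → length (vecsOver xs n) ≡ length xs ^ n
length-vecsOver xs zero    = refl
length-vecsOver xs (suc n) =
  trans (length-cartesianProductWith _∷_ xs (vecsOver xs n))
        (cong (length xs ℕ.*_) (length-vecsOver xs n))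

vecsOver-unique : ∀ {A : Set} {xs : List A} → Unique xs → ∀ n → Unique (vecsOver xs n)
vecsOver-unique uxs zero    = All.[] AllPairs.∷ AllPairs.[]
vecsOver-unique uxs (suc n) =
  UniqueP.cartesianProductWith⁺ _∷_ VP.∷-injective uxs (vecsOver-unique uxs n)

-- Tuples with several occurrences of a are listed more than once.
vecsContaining : ∀ {A : Set} → List A → A → ∀ n → List (Vec A (suc n))
vecsContaining xs a zero    = L.[ a ∷ [] ]
vecsContaining xs a (suc n) =
  L.map (a ∷_) (vecsOver xs (suc n)) ++ cartesianProductWith _∷_ xs (vecsContaining xs a n)

∈-vecsContaining : ∀ {A : Set} {xs : List A} → (∀ b → b ∈ xs) →
  ∀ {a n} {t : Vec A (suc n)} → a ∈ᵥ t → t ∈ vecsContaining xs a n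
∈-vecsContaining all∈ {n = zero}  {_ ∷ []} (VAny.here refl) = here refl
∈-vecsContaining all∈ {n = zero}  {_ ∷ []} (VAny.there ())
∈-vecsContaining all∈ {a} {suc n} {_ ∷ v}  (VAny.here refl) =
  ∈P.∈-++⁺ˡ (∈P.∈-map⁺ (a ∷_) (∈-vecsOver all∈ v))
∈-vecsContaining {xs = xs} all∈ {a} {suc n} {b ∷ v} (VAny.there a∈v) =
  ∈P.∈-++⁺ʳ (L.map (a ∷_) (vecsOver xs (suc n)))
    (∈P.∈-cartesianProductWith⁺ _∷_ (all∈ b) (∈-vecsContaining all∈ a∈v))

length-vecsContaining : ∀ {A : Set} (xs : List A) a n →
  length (vecsContaining xs a n) ℕ.≤ suc n ℕ.* length xs ^ n
length-vecsContaining xs a zero    = ℕP.≤-refl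
length-vecsContaining xs a (suc n) = begin
  length (first ++ rest)
    ≡⟨ LP.length-++ first ⟩
  length first ℕ.+ length rest
    ≡⟨ cong₂ ℕ._+_ length-first length-rest ⟩
  K ℕ.* K ^ n ℕ.+ K ℕ.* length (vecsContaining xs a n)
    ≤⟨ ℕP.+-monoʳ-≤ (K ℕ.* K ^ n) (ℕP.*-monoʳ-≤ K (length-vecsContaining xs a n)) ⟩
  K ℕ.* K ^ n ℕ.+ K ℕ.* (suc n ℕ.* K ^ n)
    ≡⟨ regroup K n (K ^ n) ⟩
  suc (suc n) ℕ.* (K ℕ.* K ^ n)
    ∎
  where
  open ℕP.≤-Reasoning
  K = length xs
  first = L.map (a ∷_) (vecsOver xs (suc n))
  rest  = cartesianProductWith _∷_ xs (vecsContaining xs a n)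
  length-first : length first ≡ K ℕ.* K ^ n
  length-first = trans (LP.length-map (a ∷_) (vecsOver xs (suc n))) (length-vecsOver xs (suc n))
  length-rest : length rest ≡ K ℕ.* length (vecsContaining xs a n)
  length-rest = length-cartesianProductWith _∷_ xs (vecsContaining xs a n)
  regroup : ∀ k n p → k ℕ.* p ℕ.+ k ℕ.* (suc n ℕ.* p) ≡ suc (suc n) ℕ.* (k ℕ.* p)
  regroup = solve-∀

Unique-containing-length≤ : ∀ {A : Set} {xs : List A} → (∀ b → b ∈ xs) →
  ∀ {a n} {ts : List (Vec A (suc n))} → Unique ts → All (a ∈ᵥ_) ts →
  length ts ℕ.≤ suc n ℕ.* length xs ^ n
Unique-containing-length≤ {xs = xs} all∈ {a} {n} uts a∈ts = ℕP.≤-trans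
  (Unique-⊆⇒length≤ uts (∈-vecsContaining all∈ ∘ All.lookup a∈ts))
  (length-vecsContaining xs a n)

cube : ∀ k → List (Vec Bool k)
cube = vecsOver (false L.∷ true L.∷ L.[])

bitWeight : Bool → ℚ → ℚ
bitWeight true  p = p
bitWeight false p = 1ℚ - p

cubeWeight : ∀ {k} → Pt k → Vec Bool k → ℚ
cubeWeight y []      = 1ℚ
cubeWeight y (b ∷ v) = bitWeight b (y fz) * cubeWeight (tail y) v

bitWeight-nonNeg : ∀ b {p} → 0ℚ ≤ p → p ≤ 1ℚ → 0ℚ ≤ bitWeight b p
bitWeight-nonNeg true  0≤p p≤1 = 0≤p
bitWeight-nonNeg false 0≤p p≤1 = p≤q⇒0≤q-p p≤1

cubeWeight-nonNeg : ∀ {k} {y : Pt k} → (∀ i → 0ℚ ≤ y i) → (∀ i → y i ≤ 1ℚ) →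
  ∀ v → 0ℚ ≤ cubeWeight y v
cubeWeight-nonNeg 0≤y y≤1 []      = 0≤1
cubeWeight-nonNeg 0≤y y≤1 (b ∷ v) =
  0≤* (bitWeight-nonNeg b (0≤y fz) (y≤1 fz)) (cubeWeight-nonNeg (0≤y ∘ fs) (y≤1 ∘ fs) v)

cubeMean : ∀ {k} → Pt k → (Vec Bool k → ℚ) → ℚ
cubeMean y h = ΣL (cube _) (λ v → cubeWeight y v * h v)

cubeMean-suc : ∀ {k} (y : Pt (suc k)) h →
  cubeMean y h ≡
    (1ℚ - y fz) * cubeMean (tail y) (h ∘ (false ∷_)) + y fz * cubeMean (tail y) (h ∘ (true ∷_))
cubeMean-suc {k} y h = begin
  cubeMean y h
    ≡⟨ ΣL-cartesianProductWith _∷_ (false L.∷ true L.∷ L.[]) (cube k) _ ⟩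
  ΣL (cube k) (λ v → (1ℚ - y fz) * cubeWeight (tail y) v * h (false ∷ v))
    + (ΣL (cube k) (λ v → y fz * cubeWeight (tail y) v * h (true ∷ v)) + 0ℚ)
    ≡⟨ cong₂ _+_ (pull (1ℚ - y fz) false) (trans (ℚP.+-identityʳ _) (pull (y fz) true)) ⟩
  (1ℚ - y fz) * cubeMean (tail y) (h ∘ (false ∷_)) + y fz * cubeMean (tail y) (h ∘ (true ∷_))
    ∎
  where
  open ≡-Reasoning
  pull : ∀ c b → ΣL (cube k) (λ v → c * cubeWeight (tail y) v * h (b ∷ v))
                   ≡ c * cubeMean (tail y) (h ∘ (b ∷_))
  pull c b = trans (ΣL-cong (cube k) λ v → ℚP.*-assoc c _ _) (ΣL-*ˡ (cube k) c _)

cubeMean-const : ∀ {k} (y : Pt k) c → cubeMean y (λ _ → c) ≡ c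
cubeMean-const {zero}  y c = solve 1 (λ c → con 1ℚ :* c :+ con 0ℚ := c) refl c
cubeMean-const {suc k} y c = begin
  cubeMean y (λ _ → c)
    ≡⟨ cubeMean-suc y (λ _ → c) ⟩
  (1ℚ - y fz) * cubeMean (tail y) (λ _ → c) + y fz * cubeMean (tail y) (λ _ → c)
    ≡⟨ cong (λ s → (1ℚ - y fz) * s + y fz * s) (cubeMean-const (tail y) c) ⟩
  (1ℚ - y fz) * c + y fz * c
    ≡⟨ solve 2 (λ a c → (con 1ℚ :- a) :* c :+ a :* c := c) refl (y fz) c ⟩
  c ∎
  where open ≡-Reasoning

cubeMean-toPt : ∀ {k} (y : Pt k) i → cubeMean y (λ v → toPt v i) ≡ y i
cubeMean-toPt {suc k} y fz = begin
  cubeMean y (λ v → toPt v fz)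
    ≡⟨ cubeMean-suc y (λ v → toPt v fz) ⟩
  (1ℚ - y fz) * cubeMean (tail y) (λ _ → 0ℚ) + y fz * cubeMean (tail y) (λ _ → 1ℚ)
    ≡⟨ cong₂ (λ s t → (1ℚ - y fz) * s + y fz * t)
             (cubeMean-const (tail y) 0ℚ) (cubeMean-const (tail y) 1ℚ) ⟩
  (1ℚ - y fz) * 0ℚ + y fz * 1ℚ
    ≡⟨ solve 1 (λ a → (con 1ℚ :- a) :* con 0ℚ :+ a :* con 1ℚ := a) refl (y fz) ⟩
  y fz ∎
  where open ≡-Reasoning
cubeMean-toPt {suc k} y (fs i) = begin
  cubeMean y (λ v → toPt v (fs i))
    ≡⟨ cubeMean-suc y (λ v → toPt v (fs i)) ⟩
  (1ℚ - y fz) * cubeMean (tail y) (λ v → toPt v i) + y fz * cubeMean (tail y) (λ v → toPt v i)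
    ≡⟨ cong (λ s → (1ℚ - y fz) * s + y fz * s) (cubeMean-toPt (tail y) i) ⟩
  (1ℚ - y fz) * y (fs i) + y fz * y (fs i)
    ≡⟨ solve 2 (λ a b → (con 1ℚ :- a) :* b :+ a :* b := b) refl (y fz) (y (fs i)) ⟩
  y (fs i) ∎
  where open ≡-Reasoning

rescale : ∀ {k} a (r : Pt k) → 0ℚ ≤ a → (∀ i → 0ℚ ≤ r i) → (∀ i → r i ≤ a) →
  Σ (Pt k) λ y → (∀ i → 0ℚ ≤ y i) × (∀ i → y i ≤ 1ℚ) × (∀ i → a * y i ≡ r i)
rescale a r 0≤a 0≤r r≤a with a ℚP.≟ 0ℚ
... | yes refl =
  (λ _ → 0ℚ) , (λ _ → ℚP.≤-refl) , (λ _ → 0≤1) , (λ i → ℚP.≤-antisym (0≤r i) (r≤a i))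
... | no a≢0 = (λ i → r i * 1/a) , (λ i → 0≤* (0≤r i) 0≤1/a) , y≤1 , a*y≡r
  where
  instance
    _ : ℚ.NonZero a
    _ = ℚ.≢-nonZero a≢0
    _ : ℚ.Positive a
    _ = ℚP.nonNeg∧nonZero⇒pos a {{ℚ.nonNegative 0≤a}}
  1/a : ℚ
  1/a = ℚ.1/ a
  0≤1/a : 0ℚ ≤ 1/a
  0≤1/a = ℚP.<⇒≤ (ℚP.positive⁻¹ 1/a {{ℚP.1/pos⇒pos a}})
  y≤1 : ∀ i → r i * 1/a ≤ 1ℚ
  y≤1 i = subst (r i * 1/a ≤_) (ℚP.*-inverseʳ a)
    (ℚP.*-monoʳ-≤-nonNeg 1/a {{ℚ.nonNegative 0≤1/a}} (r≤a i))
  a*y≡r : ∀ i → a * (r i * 1/a) ≡ r i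
  a*y≡r i = begin
    a * (r i * 1/a) ≡⟨ solve 3 (λ a r b → a :* (r :* b) := r :* (a :* b)) refl a (r i) 1/a ⟩
    r i * (a * 1/a) ≡⟨ cong (r i *_) (ℚP.*-inverseʳ a) ⟩
    r i * 1ℚ        ≡⟨ ℚP.*-identityʳ (r i) ⟩
    r i             ∎
    where open ≡-Reasoning

apex : ∀ k → Vec Bool k
apex k = V.replicate k false

pyramid : ∀ k → List (Vec Bool (suc k))
pyramid k = apex (suc k) L.∷ L.map (true ∷_) (cube k)

InPyramid : ∀ {k} → Pt (suc k) → Set
InPyramid x = (∀ i → 0ℚ ≤ x i) × (∀ j → x (fs j) ≤ x fz) × (x fz ≤ 1ℚ)

pyramid-unique : ∀ k → Unique (pyramid k)
pyramid-unique k =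
  All.tabulate apex≢top AllPairs.∷ UniqueP.map⁺ VP.∷-injectiveʳ (vecsOver-unique bits-unique k)
  where
  bits-unique : Unique (false L.∷ true L.∷ L.[])
  bits-unique = ((λ ()) All.∷ All.[]) AllPairs.∷ All.[] AllPairs.∷ AllPairs.[]
  apex≢top : ∀ {v} → v ∈ L.map (true ∷_) (cube k) → apex (suc k) ≢ v
  apex≢top v∈ apex≡v with ∈P.∈-map⁻ (true ∷_) v∈
  apex≢top v∈ () | _ , _ , refl

length-pyramid : ∀ k → length (pyramid k) ≡ suc (2 ^ k)
length-pyramid k = cong suc (trans (LP.length-map (true ∷_) (cube k)) (length-vecsOver _ k))

toPt-apex : ∀ k i → toPt (apex k) i ≡ 0ℚ
toPt-apex k i = cong b2q (VP.lookup-replicate i false)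

vertices-InPyramid : ∀ k → All (InPyramid ∘ toPt) (pyramid k)
vertices-InPyramid k = apex-InPyramid All.∷ AllP.map⁺ (All.universal top (cube k))
  where
  apex-InPyramid : InPyramid (toPt (apex (suc k)))
  apex-InPyramid = (λ i → ℚP.≤-reflexive (sym (toPt-apex (suc k) i))) ,
         (λ j → ℚP.≤-reflexive (toPt-apex (suc k) (fs j))) , 0≤1
  b2q-nonNeg : ∀ b → 0ℚ ≤ b2q b
  b2q-nonNeg true  = 0≤1
  b2q-nonNeg false = ℚP.≤-refl
  b2q≤1 : ∀ b → b2q b ≤ 1ℚ
  b2q≤1 true  = ℚP.≤-refl
  b2q≤1 false = 0≤1
  top : ∀ v → InPyramid (toPt (true ∷ v))
  top v = (λ i → b2q-nonNeg (V.lookup (true ∷ v) i)) , (λ j → b2q≤1 (V.lookup v j)) ,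
          ℚP.≤-refl

vertex-InPyramid : ∀ k j → InPyramid (toPt (L.lookup (pyramid k) j))
vertex-InPyramid k j = All.lookup (vertices-InPyramid k) (∈P.∈-lookup {xs = pyramid k} j)

InConv⇒InPyramid : ∀ {k} (x : Pt (suc k)) → InConv (pyramid k) x → InPyramid x
InConv⇒InPyramid {k} x (w , 0≤w , Σw≡1 , Σwv≡x) = 0≤x , x≤x₀ , x₀≤1
  where
  v = vertex-InPyramid k
  0≤x : ∀ i → 0ℚ ≤ x i
  0≤x i = subst (0ℚ ≤_) (Σwv≡x i) (Σℚ-nonNeg λ j → 0≤* (0≤w j) (proj₁ (v j) i))
  x≤x₀ : ∀ i → x (fs i) ≤ x fz
  x≤x₀ i = subst₂ _≤_ (Σwv≡x (fs i)) (Σwv≡x fz)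
    (Σℚ-mono-≤ λ j → *-monoˡ-≤-0≤ (0≤w j) (proj₁ (proj₂ (v j)) i))
  x₀≤1 : x fz ≤ 1ℚ
  x₀≤1 = subst₂ _≤_ (Σwv≡x fz) (trans (Σℚ-cong λ j → ℚP.*-identityʳ (w j)) Σw≡1)
    (Σℚ-mono-≤ λ j → *-monoˡ-≤-0≤ (0≤w j) (proj₂ (proj₂ (v j))))

-- x = (1 - x₀)·apex + x₀·(1, y) with y = (x₁, …)/x₀, and (1, y) is the
-- cubeWeight y-mean of the top face.
InPyramid⇒InConv : ∀ {k} (x : Pt (suc k)) → InPyramid x → InConv (pyramid k) x
InPyramid⇒InConv {k} x (0≤x , x≤x₀ , x₀≤1)
  with y , 0≤y , y≤1 , x₀*y≡x ← rescale (x fz) (tail x) (0≤x fz) (0≤x ∘ fs) x≤x₀ =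
  W ∘ L.lookup (pyramid k) , W-nonNeg ∘ L.lookup (pyramid k) , ΣW≡1 , ΣWv≡x
  where
  open ≡-Reasoning
  W : Vec Bool (suc k) → ℚ
  W (false ∷ _) = 1ℚ - x fz
  W (true ∷ v)  = cubeWeight y v * x fz
  W-nonNeg : ∀ v → 0ℚ ≤ W v
  W-nonNeg (false ∷ _) = p≤q⇒0≤q-p x₀≤1
  W-nonNeg (true ∷ v)  = 0≤* (cubeWeight-nonNeg 0≤y y≤1 v) (0≤x fz)
  ΣW≡1 : Σℚ (W ∘ L.lookup (pyramid k)) ≡ 1ℚ
  ΣW≡1 = begin
    Σℚ (W ∘ L.lookup (pyramid k))
      ≡⟨ Σℚ-lookup (pyramid k) W ⟩
    (1ℚ - x fz) + ΣL (L.map (true ∷_) (cube k)) W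
      ≡⟨ cong ((1ℚ - x fz) +_) (trans (ΣL-map (true ∷_) (cube k) W) (cubeMean-const y (x fz))) ⟩
    (1ℚ - x fz) + x fz
      ≡⟨ solve 1 (λ a → (con 1ℚ :- a) :+ a := con 1ℚ) refl (x fz) ⟩
    1ℚ ∎
  top : ∀ h → ΣL (L.map (true ∷_) (cube k)) (λ v → W v * h v) ≡ x fz * cubeMean y (h ∘ (true ∷_))
  top h = begin
    ΣL (L.map (true ∷_) (cube k)) (λ v → W v * h v)
      ≡⟨ ΣL-map (true ∷_) (cube k) _ ⟩
    ΣL (cube k) (λ v → cubeWeight y v * x fz * h (true ∷ v))
      ≡⟨ ΣL-cong (cube k) (λ v → swap (cubeWeight y v) (x fz) (h (true ∷ v))) ⟩
    ΣL (cube k) (λ v → x fz * (cubeWeight y v * h (true ∷ v)))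
      ≡⟨ ΣL-*ˡ (cube k) (x fz) _ ⟩
    x fz * cubeMean y (h ∘ (true ∷_)) ∎
    where
    swap : ∀ w a t → w * a * t ≡ a * (w * t)
    swap = solve 3 (λ w a t → w :* a :* t := a :* (w :* t)) refl
  x₀*mean≡x : ∀ i → x fz * cubeMean y (λ v → toPt (true ∷ v) i) ≡ x i
  x₀*mean≡x fz     = trans (cong (x fz *_) (cubeMean-const y 1ℚ)) (ℚP.*-identityʳ (x fz))
  x₀*mean≡x (fs i) = trans (cong (x fz *_) (cubeMean-toPt y i)) (x₀*y≡x i)
  ΣWv≡x : ∀ i → Σℚ (λ j → W (L.lookup (pyramid k) j) * toPt (L.lookup (pyramid k) j) i) ≡ x i
  ΣWv≡x i = begin
    Σℚ (λ j → W (L.lookup (pyramid k) j) * toPt (L.lookup (pyramid k) j) i)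
      ≡⟨ Σℚ-lookup (pyramid k) (λ v → W v * toPt v i) ⟩
    (1ℚ - x fz) * toPt (apex (suc k)) i + ΣL (L.map (true ∷_) (cube k)) (λ v → W v * toPt v i)
      ≡⟨ cong₂ _+_ (trans (cong ((1ℚ - x fz) *_) (toPt-apex (suc k) i)) (ℚP.*-zeroʳ (1ℚ - x fz)))
                   (trans (top (λ v → toPt v i)) (x₀*mean≡x i)) ⟩
    0ℚ + x i
      ≡⟨ ℚP.+-identityˡ (x i) ⟩
    x i ∎

_·e_ : ∀ {n} → ℤ → Fin n → Fin n → ℤ
(s ·e fz)   fz     = s
(s ·e fz)   (fs i) = 0ℤ
(s ·e fs j) fz     = 0ℤ
(s ·e fs j) (fs i) = (s ·e j) i

∣·e∣≤∣s∣ : ∀ {n} s (j i : Fin n) → ℤ.∣ (s ·e j) i ∣ ℕ.≤ ℤ.∣ s ∣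
∣·e∣≤∣s∣ s fz     fz     = ℕP.≤-refl
∣·e∣≤∣s∣ s fz     (fs i) = z≤n
∣·e∣≤∣s∣ s (fs j) fz     = z≤n
∣·e∣≤∣s∣ s (fs j) (fs i) = ∣·e∣≤∣s∣ s j i

sideNormal : ∀ {k} → Fin k → Fin (suc k) → ℤ
sideNormal j fz     = -1ℤ
sideNormal j (fs i) = (1ℤ ·e j) i

Satisfies : ∀ {m} → Pt m → (Fin m → ℤ) × ℚ → Set
Satisfies x (a , b) = dot (λ i → ℤ→ℚ (a i)) x ≤ b

ℤ→ℚ-1*p≡-p : ∀ p → ℤ→ℚ -1ℤ * p ≡ - p
ℤ→ℚ-1*p≡-p p = trans (sym (ℚP.neg-distribˡ-* 1ℚ p)) (cong -_ (ℚP.*-identityˡ p))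

dot-·e : ∀ {n} s (j : Fin n) (x : Pt n) → dot (λ i → ℤ→ℚ ((s ·e j) i)) x ≡ ℤ→ℚ s * x j
dot-·e s fz     x =
  trans (cong (ℤ→ℚ s * x fz +_) (Σℚ-0 λ i → ℚP.*-zeroˡ (x (fs i)))) (ℚP.+-identityʳ _)
dot-·e s (fs j) x =
  trans (cong₂ _+_ (ℚP.*-zeroˡ (x fz)) (dot-·e s j (tail x))) (ℚP.+-identityˡ _)

dot-1·e : ∀ {n} (j : Fin n) (x : Pt n) → dot (λ i → ℤ→ℚ ((1ℤ ·e j) i)) x ≡ x j
dot-1·e j x = trans (dot-·e 1ℤ j x) (ℚP.*-identityˡ (x j))

dot--1·e : ∀ {n} (j : Fin n) (x : Pt n) → dot (λ i → ℤ→ℚ ((-1ℤ ·e j) i)) x ≡ - x j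
dot--1·e j x = trans (dot-·e -1ℤ j x) (ℤ→ℚ-1*p≡-p (x j))

dot-sideNormal : ∀ {k} (j : Fin k) (x : Pt (suc k)) →
  dot (λ i → ℤ→ℚ (sideNormal j i)) x ≡ - x fz + x (fs j)
dot-sideNormal j x = cong₂ _+_ (ℤ→ℚ-1*p≡-p (x fz)) (dot-1·e j (tail x))

nonNegFacets sideFacets pyramidFacets : ∀ k → List ((Fin (suc k) → ℤ) × ℚ)
nonNegFacets  k = L.tabulate (λ i → -1ℤ ·e i , 0ℚ)
sideFacets    k = L.tabulate (λ j → sideNormal j , 0ℚ)
pyramidFacets k = nonNegFacets k ++ sideFacets k ++ L.[ 1ℤ ·e fz , 1ℚ ]

pyramidFacets-unary : ∀ k → All (λ ab → ∀ i → ℤ.∣ proj₁ ab i ∣ ℕ.≤ 1) (pyramidFacets k)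
pyramidFacets-unary k =
  AllP.++⁺ (AllP.tabulate⁺ {f = λ i → -1ℤ ·e i , 0ℚ} (∣·e∣≤∣s∣ -1ℤ))
    (AllP.++⁺ (AllP.tabulate⁺ {f = λ j → sideNormal j , 0ℚ} sideNormal-unary)
      (∣·e∣≤∣s∣ 1ℤ fz All.∷ All.[]))
  where
  sideNormal-unary : ∀ (j : Fin k) i → ℤ.∣ sideNormal j i ∣ ℕ.≤ 1
  sideNormal-unary j fz     = ℕP.≤-refl
  sideNormal-unary j (fs i) = ∣·e∣≤∣s∣ 1ℤ j i

InPyramid⇒Satisfies : ∀ {k} (x : Pt (suc k)) → InPyramid x → All (Satisfies x) (pyramidFacets k)
InPyramid⇒Satisfies x (0≤x , x≤x₀ , x₀≤1) =
  AllP.++⁺ (AllP.tabulate⁺ {f = λ i → -1ℤ ·e i , 0ℚ} nonNeg)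
    (AllP.++⁺ (AllP.tabulate⁺ {f = λ j → sideNormal j , 0ℚ} side) (top All.∷ All.[]))
  where
  nonNeg : ∀ i → Satisfies x (-1ℤ ·e i , 0ℚ)
  nonNeg i = subst (_≤ 0ℚ) (sym (dot--1·e i x)) (ℚP.neg-antimono-≤ (0≤x i))
  side : ∀ j → Satisfies x (sideNormal j , 0ℚ)
  side j = subst₂ _≤_ (sym (dot-sideNormal j x)) (ℚP.+-inverseˡ (x fz))
    (ℚP.+-monoʳ-≤ (- x fz) (x≤x₀ j))
  top : Satisfies x (1ℤ ·e fz , 1ℚ)
  top = subst (_≤ 1ℚ) (sym (dot-1·e fz x)) x₀≤1

Satisfies⇒InPyramid : ∀ {k} (x : Pt (suc k)) → All (Satisfies x) (pyramidFacets k) → InPyramid x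
Satisfies⇒InPyramid {k} x sat = 0≤x , x≤x₀ , x₀≤1
  where
  nonNeg : ∀ i → Satisfies x (-1ℤ ·e i , 0ℚ)
  nonNeg = AllP.tabulate⁻ {f = λ i → -1ℤ ·e i , 0ℚ} (AllP.++⁻ˡ (nonNegFacets k) sat)
  side : ∀ j → Satisfies x (sideNormal j , 0ℚ)
  side = AllP.tabulate⁻ (AllP.++⁻ˡ (sideFacets k) (AllP.++⁻ʳ (nonNegFacets k) sat))
  top : All (Satisfies x) L.[ 1ℤ ·e fz , 1ℚ ]
  top = AllP.++⁻ʳ (sideFacets k) (AllP.++⁻ʳ (nonNegFacets k) sat)
  0≤x : ∀ i → 0ℚ ≤ x i
  0≤x i = subst (0ℚ ≤_) (neg-involutive (x i))
    (ℚP.neg-antimono-≤ (subst (_≤ 0ℚ) (dot--1·e i x) (nonNeg i)))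
  x≤x₀ : ∀ j → x (fs j) ≤ x fz
  x≤x₀ j = subst₂ _≤_ (cancel (x fz) (x (fs j))) (ℚP.+-identityʳ (x fz))
    (ℚP.+-monoʳ-≤ (x fz) (subst (_≤ 0ℚ) (dot-sideNormal j x) (side j)))
    where
    cancel : ∀ a b → a + (- a + b) ≡ b
    cancel = solve 2 (λ a b → a :+ (:- a :+ b) := b) refl
  x₀≤1 : x fz ≤ 1ℚ
  x₀≤1 = subst (_≤ 1ℚ) (dot-1·e fz x) (All.head top)

pyramid-complexity≤1 : ∀ k → FacetComplexityAtMost 1 (pyramid k)
pyramid-complexity≤1 k = pyramidFacets k , L.[] , pyramidFacets-unary k , λ x → mk⇔
  (λ x∈P → InPyramid⇒Satisfies x (InConv⇒InPyramid x x∈P) , All.[])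
  (λ sat → InPyramid⇒InConv x (Satisfies⇒InPyramid x (proj₁ sat)))

-- With zero normals every inequality is constant, so P is cut out by linear equations alone.
complexity0⇒InConv-* : ∀ {m} {F : List (Vec Bool m)} → FacetComplexityAtMost 0 F →
  InConv F (λ _ → 0ℚ) → ∀ {x} → InConv F x → ∀ c → InConv F (λ i → c * x i)
complexity0⇒InConv-* {m} (ineqs , eqs , zero-normals , conv⇔) 0∈P {x} x∈P c =
  from (conv⇔ cx) (inequalities-hold zero-normals (proj₁ (to (conv⇔ (λ _ → 0ℚ)) 0∈P)) ,
                   All.map (λ {h} → scaled {h}) (proj₂ (to (conv⇔ x) x∈P)))
  where
  open Equivalence using (to; from)
  cx : Pt m
  cx i = c * x i
  constant : ∀ {ab : (Fin m → ℤ) × ℚ} → (∀ i → ℤ.∣ proj₁ ab i ∣ ℕ.≤ 0) × Satisfies (λ _ → 0ℚ) ab →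
    Satisfies cx ab
  constant {a , b} (a≡0 , sat) = subst (_≤ b) (trans (dot≡0 (λ _ → 0ℚ)) (sym (dot≡0 cx))) sat
    where
    a≡0ℤ : ∀ i → a i ≡ 0ℤ
    a≡0ℤ i = ℤP.∣i∣≡0⇒i≡0 (ℕP.n≤0⇒n≡0 (a≡0 i))
    dot≡0 : ∀ y → dot (λ i → ℤ→ℚ (a i)) y ≡ 0ℚ
    dot≡0 y = Σℚ-0 λ i → trans (cong (λ z → ℤ→ℚ z * y i) (a≡0ℤ i)) (ℚP.*-zeroˡ (y i))
  inequalities-hold : ∀ {abs} → All (λ ab → ∀ i → ℤ.∣ proj₁ ab i ∣ ℕ.≤ 0) abs →
    All (Satisfies (λ _ → 0ℚ)) abs → All (Satisfies cx) abs
  inequalities-hold zs ss = All.zipWith (λ {ab} → constant {ab}) (zs , ss)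
  scaled : ∀ {h} → dot h x ≡ 0ℚ → dot h cx ≡ 0ℚ
  scaled {h} hx≡0 = trans (dot-*ʳ h x c) (trans (cong (c *_) hx≡0) (ℚP.*-zeroʳ c))

¬pyramid-complexity≤0 : ∀ k → ¬ FacetComplexityAtMost 0 (pyramid k)
¬pyramid-complexity≤0 k fc =
  from-no (ℕ→ℚ 2 * 1ℚ ℚP.≤? 1ℚ) (proj₂ (proj₂ (InConv⇒InPyramid _ 2e₀∈P)))
  where
  origin : InPyramid {k} (λ _ → 0ℚ)
  origin = (λ _ → ℚP.≤-refl) , (λ _ → ℚP.≤-refl) , 0≤1
  e₀ : Pt (suc k)
  e₀ fz     = 1ℚ
  e₀ (fs _) = 0ℚ
  e₀∈P : InPyramid e₀
  e₀∈P = (λ { fz → 0≤1 ; (fs _) → ℚP.≤-refl }) , (λ _ → 0≤1) , ℚP.≤-refl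
  2e₀∈P : InConv (pyramid k) (λ i → ℕ→ℚ 2 * e₀ i)
  2e₀∈P = complexity0⇒InConv-* {F = pyramid k} fc
    (InPyramid⇒InConv _ origin) (InPyramid⇒InConv e₀ e₀∈P) (ℕ→ℚ 2)

pyramid-complexity1 : ∀ k → UnaryFacetComplexityOne (pyramid k)
pyramid-complexity1 k = pyramid-complexity≤1 k , ¬pyramid-complexity≤0 k

sqDist≤⇒coord-close : ∀ {m} (y z : Pt m) {r} → 0ℚ ≤ r → sqDist y z ≤ r * r →
  ∀ i → z i - r ≤ y i × y i ≤ z i + r
sqDist≤⇒coord-close y z {r} 0≤r d≤r² i =
  subst (z i - r ≤_) z+d≡y (ℚP.+-monoʳ-≤ (z i) (proj₁ -r≤d≤r)) ,
  subst (_≤ z i + r) z+d≡y (ℚP.+-monoʳ-≤ (z i) (proj₂ -r≤d≤r))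
  where
  -r≤d≤r : - r ≤ y i - z i × y i - z i ≤ r
  -r≤d≤r = p*p≤q*q⇒-q≤p≤q 0≤r (ℚP.≤-trans (f≤Σℚf (λ j → 0≤p*p (y j - z j)) i) d≤r²)
  z+d≡y : z i + (y i - z i) ≡ y i
  z+d≡y = solve 2 (λ a b → a :+ (b :- a) := b) refl (z i) (y i)

ballCentre : ∀ {k} → Pt (suc k)
ballCentre fz     = ℤ.+ 3 / 4
ballCentre (fs _) = ℤ.+ 3 / 8

pyramid-ball : ∀ k → ContainsBall (pyramid k) (ℤ.+ 1 / 8)
pyramid-ball k = ballCentre , λ y d≤r² → InPyramid⇒InConv y (inside y d≤r²)
  where
  r = ℤ.+ 1 / 8
  0≤centre-r : ∀ i → 0ℚ ≤ ballCentre {k} i - r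
  0≤centre-r fz     = from-yes (0ℚ ℚP.≤? ballCentre {k} fz - r)
  0≤centre-r (fs i) = from-yes (0ℚ ℚP.≤? ballCentre {k} (fs i) - r)
  inside : ∀ y → sqDist y ballCentre ≤ r * r → InPyramid y
  inside y d≤r² = (λ i → ℚP.≤-trans (0≤centre-r i) (proj₁ (close i))) ,
    (λ j → ℚP.≤-trans (proj₂ (close (fs j)))
             (ℚP.≤-trans (from-yes (ℤ.+ 3 / 8 + r ℚP.≤? ℤ.+ 3 / 4 - r)) (proj₁ (close fz)))) ,
    ℚP.≤-trans (proj₂ (close fz)) (from-yes (ℤ.+ 3 / 4 + r ℚP.≤? 1ℚ))
    where
    close = sqDist≤⇒coord-close y ballCentre (from-yes (0ℚ ℚP.≤? r)) d≤r²

max-head⇒InBoundary : ∀ {k} (F : List (Vec Bool (suc k))) {x : Pt (suc k)} → InConv F x →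
  (∀ y → InConv F y → y fz ≤ x fz) → InBoundary F x
max-head⇒InBoundary {k} F {x} x∈P max = x∈P , escape
  where
  escape : ∀ ε → 0ℚ < ε → Σ (Pt (suc k)) λ y → sqDist y x < ε × ¬ InConv F y
  escape ε 0<ε with δ , 0<δ , δ²<ε ← ∃δ²<ε ε 0<ε =
    y , subst (_< ε) (sym dist) δ²<ε ,
    λ y∈P → ℚP.<-irrefl refl (ℚP.<-≤-trans x₀<y₀ (max y y∈P))
    where
    y : Pt (suc k)
    y fz     = x fz + δ
    y (fs i) = x (fs i)
    dist : sqDist y x ≡ δ * δ
    dist = trans
      (cong₂ _+_ (solve 2 (λ a d → (a :+ d :- a) :* (a :+ d :- a) := d :* d) refl (x fz) δ)
                 (Σℚ-0 λ i → solve 1 (λ a → (a :- a) :* (a :- a) := con 0ℚ) refl (x (fs i))))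
      (ℚP.+-identityʳ (δ * δ))
    x₀<y₀ : x fz < x fz + δ
    x₀<y₀ = subst (_< x fz + δ) (ℚP.+-identityʳ (x fz)) (ℚP.+-monoʳ-< (x fz) 0<δ)

Sample : ∀ k n → Set
Sample k n = Vec (Fin (length (pyramid k))) (suc n)

average-InPyramid : ∀ k {n} (t : Sample k n) → InPyramid (average (pyramid k) t)
average-InPyramid k {n} t =
  (λ i → 0≤* (0≤1/[1+n] n) (Σℚ-nonNeg λ l → proj₁ (v l) i)) ,
  (λ j → *-monoˡ-≤-0≤ (0≤1/[1+n] n) (Σℚ-mono-≤ λ l → proj₁ (proj₂ (v l)) j)) ,
  ℚP.≤-trans (*-monoˡ-≤-0≤ (0≤1/[1+n] n) (Σℚ-mono-≤ λ l → proj₂ (proj₂ (v l))))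
             (ℚP.≤-reflexive (1/[1+n]*Σℚ1≡1 n))
  where
  v : ∀ l → InPyramid (toPt (L.lookup (pyramid k) (V.lookup t l)))
  v l = vertex-InPyramid k (V.lookup t l)

nonApex-head≡1 : ∀ k (j : Fin (length (pyramid k))) → j ≢ fz →
  toPt (L.lookup (pyramid k) j) fz ≡ 1ℚ
nonApex-head≡1 k fz     j≢fz = contradiction refl j≢fz
nonApex-head≡1 k (fs j) _
  with _ , _ , v≡true∷ ← ∈P.∈-map⁻ (true ∷_) (∈P.∈-lookup {xs = L.map (true ∷_) (cube k)} j) =
  cong (λ v → toPt v fz) v≡true∷

apex-free⇒InBoundary : ∀ k {n} (t : Sample k n) → (∀ l → V.lookup t l ≢ fz) →
  InBoundary (pyramid k) (average (pyramid k) t)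
apex-free⇒InBoundary k {n} t avoid =
  max-head⇒InBoundary (pyramid k) (InPyramid⇒InConv _ (average-InPyramid k t))
    λ y y∈P → subst (y fz ≤_) (sym average₀≡1) (proj₂ (proj₂ (InConv⇒InPyramid y y∈P)))
  where
  average₀≡1 : average (pyramid k) t fz ≡ 1ℚ
  average₀≡1 = trans
    (cong ((ℤ.+ 1 / suc n) *_) (Σℚ-cong λ l → nonApex-head≡1 k (V.lookup t l) (avoid l)))
    (1/[1+n]*Σℚ1≡1 n)

nonBoundary⇒apex∈ : ∀ k {n} (t : Sample k n) →
  ¬ InBoundary (pyramid k) (average (pyramid k) t) → fz ∈ᵥ t
nonBoundary⇒apex∈ k t ¬∂ with VAny.any? (fz Fin.≟_) t
... | yes fz∈t = fz∈t
... | no  fz∉t = contradiction (apex-free⇒InBoundary k t avoid) ¬∂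
  where
  avoid : ∀ l → V.lookup t l ≢ fz
  avoid l t[l]≡fz = fz∉t (subst (_∈ᵥ t) t[l]≡fz (∈ᵥP.∈-lookup l t))

nonBoundary-count : ∀ k n (S : List (Sample k n)) → Unique S →
  All (λ t → ¬ InBoundary (pyramid k) (average (pyramid k) t)) S →
  length S ℕ.* 2 ^ suc k ℕ.≤ 2 ℕ.* suc n ℕ.* length (pyramid k) ^ suc n
nonBoundary-count k n S uS nb = begin
  length S ℕ.* 2 ^ suc k        ≤⟨ ℕP.*-mono-≤ count 2^[1+k]≤2K ⟩
  suc n ℕ.* K ^ n ℕ.* (2 ℕ.* K) ≡⟨ regroup (suc n) K (K ^ n) ⟩
  2 ℕ.* suc n ℕ.* K ^ suc n     ∎
  where
  open ℕP.≤-Reasoning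
  K = length (pyramid k)
  count : length S ℕ.≤ suc n ℕ.* K ^ n
  count = subst (λ l → length S ℕ.≤ suc n ℕ.* l ^ n) (LP.length-tabulate (λ i → i))
    (Unique-containing-length≤ ∈P.∈-allFin uS (All.map (λ {t} → nonBoundary⇒apex∈ k t) nb))
  2^[1+k]≤2K : 2 ^ suc k ℕ.≤ 2 ℕ.* K
  2^[1+k]≤2K = ℕP.*-monoʳ-≤ 2 (subst (2 ^ k ℕ.≤_) (sym (length-pyramid k)) (ℕP.n≤1+n _))
  regroup : ∀ s k p → s ℕ.* p ℕ.* (2 ℕ.* k) ≡ 2 ℕ.* s ℕ.* (k ℕ.* p)
  regroup = solve-∀

theoremA1 : Σ ℚ λ c → Σ ℚ λ C → (0ℚ < c) × (0ℚ < C) ×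
    (∀ (m : ℕ) → 1 ℕ.≤ m →
      Σ (List (Vec Bool m)) λ F →
        Unique F × ContainsBall F c × UnaryFacetComplexityOne F ×
        (∀ (n : ℕ) → suc n ℕ.≤ 2 ^ m →
          ∀ (S : List (Vec (Fin (length F)) (suc n))) → Unique S →
          All (λ t → ¬ InBoundary F (average F t)) S →
          ℕ→ℚ (length S) * ℕ→ℚ (2 ^ m) ≤ C * ℕ→ℚ (suc n) * ℕ→ℚ (length F ^ suc n)))
theoremA1 =
  ℤ.+ 1 / 8 , ℕ→ℚ 2 , from-yes (0ℚ ℚP.<? ℤ.+ 1 / 8) , from-yes (0ℚ ℚP.<? ℕ→ℚ 2) , λ where
    zero    ()
    (suc k) _ → pyramid k , pyramid-unique k , pyramid-ball k , pyramid-complexity1 k ,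
      λ n _ S uS nb → ℕ→ℚ-mono-≤-* (length S) (2 ^ suc k) 2 (suc n) (length (pyramid k) ^ suc n)
        (nonBoundary-count k n S uS nb)
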